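{- (i) For all integers $0\le k\le a$, the central binomial coefficient $\binom{2k}{k}$ divides $\binom{2a}{a}\binom{a}{k}$. (ii) For all integers $\ell,m\ge0$, $\binom{2\ell}{\ell}\,p_\ell(m)\in\mathbb Z$. (iii) For all integers $\ell,m\ge0$, $\sigma(\ell,m):=\binom{2\ell}{\ell}\binom{2m}{m}p_\ell(m)^2\in\mathbb Z$.
   Context: $p_\ell(m):=\sum_{k=0}^{\ell}2^{3k}\binom{m}{k}\binom{\ell}{k}\binom{2k}{k}^{ -1}$ for integers $\ell,m\ge0$. -}

module Defs where

open import Data.Nat using (ℕ; zero; suc; _+_; _*_; _^_; _≤_; _<_; z≤n; s≤s; z<s; NonZero; >-nonZero)
open import Data.Nat.Properties using (<-≤-trans; m≤m+n)
open import Data.Nat.Combinatorics using (_C_; nCk+nC[k+1]≡[n+1]C[k+1])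
open import Data.Integer using (ℤ; +_)
open import Data.Rational using (ℚ; _/_) renaming (_+_ to _+ℚ_)
open import Relation.Binary.PropositionalEquality using (_≡_; refl; sym; subst)

nCk>0 : ∀ n k → k ≤ n → 0 < n C k
nCk>0 n       zero    _         = z<s
nCk>0 (suc n) (suc k) (s≤s k≤n) =
  subst (0 <_) (nCk+nC[k+1]≡[n+1]C[k+1] n k)
        (<-≤-trans (nCk>0 n k k≤n) (m≤m+n (n C k) (n C suc k)))

k≤2k : ∀ k → k ≤ k + k
k≤2k k = m≤m+n k k

centralBinom : ℕ → ℕ
centralBinom k = (k + k) C k

centralBinom-nonZero : ∀ k → NonZero (centralBinom k)
centralBinom-nonZero k = >-nonZero (nCk>0 (k + k) k (k≤2k k))

term : ℕ → ℕ → ℕ → ℚ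
term ℓ m k = (+ (2 ^ (3 * k) * (m C k) * (ℓ C k)) / centralBinom k)
  {{centralBinom-nonZero k}}

sumTo : ℕ → (ℕ → ℚ) → ℚ
sumTo zero    f = f 0
sumTo (suc n) f = sumTo n f +ℚ f (suc n)

p : ℕ → ℕ → ℚ
p ℓ m = sumTo ℓ (term ℓ m)

ℤ→ℚ : ℤ → ℚ
ℤ→ℚ z = z / 1

-- Write B n = C(2n, n). The quotient B(a)·C(a,k)/B(k) satisfies the recurrence
-- f(a+1, k+1) = 4 f(a, k+1) + f(a, k) with integral boundary values f(a, 0) = B(a) and
-- f(0, k+1) = 0, so it is an integer; this is (i). The k-th summand of B(ℓ)·p_ℓ(m) is
-- 2^{3k} C(m,k) · B(ℓ)C(ℓ,k)/B(k), an integer by (i), and symmetrically B(m)·p_ℓ(m) is an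
-- integer; (iii) is the product of these two.
module Submission where

open import Defs

module CentralBinomialDivisibility where

  open import Data.Nat
  open import Data.Nat.Properties
  open import Data.Nat.Combinatorics
  open import Data.Nat.Divisibility using (_∣_; divides; ∣-trans; *-monoʳ-∣; n∣m*n; n∣m*n*o)
  open import Data.Nat.Tactic.RingSolver using (solve-∀)
  open import Relation.Binary.PropositionalEquality
  open import Algebra.Properties.CommutativeSemigroup *-commutativeSemigroup
    using (x∙yz≈y∙xz; x∙yz≈yx∙z; xy∙z≈y∙xz)
  open ≡-Reasoning

  [k+1]*[n+1]C[k+1]≡[n+1]*nCk : ∀ n k → suc k * (suc n C suc k) ≡ suc n * (n C k)
  [k+1]*[n+1]C[k+1]≡[n+1]*nCk n       zero    =
    trans (*-identityˡ (suc n C 1)) (trans (nC1≡n (suc n)) (sym (*-identityʳ (suc n))))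
  [k+1]*[n+1]C[k+1]≡[n+1]*nCk zero    (suc k) = *-zeroʳ (2 + k)
  [k+1]*[n+1]C[k+1]≡[n+1]*nCk (suc n) (suc k) = begin
    (2 + k) * ((2 + n) C (2 + k))
      ≡⟨ cong ((2 + k) *_) (nCk+nC[k+1]≡[n+1]C[k+1] (suc n) (suc k)) ⟨
    (2 + k) * (X + Y)
      ≡⟨ *-distribˡ-+ (2 + k) X Y ⟩
    X + (1 + k) * X + (2 + k) * Y
      ≡⟨ cong₂ (λ u v → X + u + v) ([k+1]*[n+1]C[k+1]≡[n+1]*nCk n k) ([k+1]*[n+1]C[k+1]≡[n+1]*nCk n (suc k)) ⟩
    X + (1 + n) * (n C k) + (1 + n) * (n C suc k)
      ≡⟨ +-assoc X ((1 + n) * (n C k)) _ ⟩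
    X + ((1 + n) * (n C k) + (1 + n) * (n C suc k))
      ≡⟨ cong (X +_) (*-distribˡ-+ (1 + n) (n C k) (n C suc k)) ⟨
    X + (1 + n) * (n C k + n C suc k)
      ≡⟨ cong (λ u → X + (1 + n) * u) (nCk+nC[k+1]≡[n+1]C[k+1] n k) ⟩
    (2 + n) * X
      ∎
    where
    X = suc n C suc k
    Y = suc n C (2 + k)

  centralBinom-suc : ∀ n → centralBinom (suc n) ≡ 2 * (suc (n + n) C suc n)
  centralBinom-suc n = begin
    (suc n + suc n) C suc n                   ≡⟨ cong (λ m → suc m C suc n) (+-suc n n) ⟩
    suc (suc (n + n)) C suc n                 ≡⟨ nCk+nC[k+1]≡[n+1]C[k+1] (suc (n + n)) n ⟨
    suc (n + n) C n + suc (n + n) C suc n     ≡⟨ cong (_+ suc (n + n) C suc n) symmetric ⟩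
    suc (n + n) C suc n + suc (n + n) C suc n ≡⟨ cong (suc (n + n) C suc n +_) (+-identityʳ _) ⟨
    2 * (suc (n + n) C suc n)                 ∎
    where
    symmetric : suc (n + n) C n ≡ suc (n + n) C suc n
    symmetric = trans (nCk≡nC[n∸k] (m≤n⇒m≤1+n (m≤m+n n n)))
      (cong (suc (n + n) C_) (trans (cong (_∸ n) (sym (+-suc n n))) (m+n∸m≡n n (suc n))))

  [n+1]*centralBinom[n+1]≡2[2n+1]*centralBinom[n] : ∀ n →
    suc n * centralBinom (suc n) ≡ 2 * suc (n + n) * centralBinom n
  [n+1]*centralBinom[n+1]≡2[2n+1]*centralBinom[n] n = begin
    suc n * centralBinom (suc n)         ≡⟨ cong (suc n *_) (centralBinom-suc n) ⟩
    suc n * (2 * (suc (n + n) C suc n))  ≡⟨ x∙yz≈y∙xz (suc n) 2 (suc (n + n) C suc n) ⟩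
    2 * (suc n * (suc (n + n) C suc n))  ≡⟨ cong (2 *_) ([k+1]*[n+1]C[k+1]≡[n+1]*nCk (n + n) n) ⟩
    2 * (suc (n + n) * centralBinom n)   ≡⟨ *-assoc 2 (suc (n + n)) (centralBinom n) ⟨
    2 * suc (n + n) * centralBinom n     ∎

  -- (k+1)·C(n,k+1) = (n−k)·C(n,k), scaled and rearranged so that no subtraction occurs.
  4[k+1]nC[k+1]+2[2k+1]nCk≡2[2n+1]nCk : ∀ n k →
    4 * (suc k * (n C suc k)) + 2 * suc (k + k) * (n C k) ≡ 2 * suc (n + n) * (n C k)
  4[k+1]nC[k+1]+2[2k+1]nCk≡2[2n+1]nCk n k = +-cancelʳ-≡ (2 * (n C k)) _ _ (begin
    4 * (suc k * (n C suc k)) + 2 * suc (k + k) * (n C k) + 2 * (n C k)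
      ≡⟨ regroup k (n C k) (n C suc k) ⟩
    4 * (suc k * (n C k) + suc k * (n C suc k))
      ≡⟨ cong (4 *_) (*-distribˡ-+ (suc k) (n C k) (n C suc k)) ⟨
    4 * (suc k * (n C k + n C suc k))
      ≡⟨ cong (λ m → 4 * (suc k * m)) (nCk+nC[k+1]≡[n+1]C[k+1] n k) ⟩
    4 * (suc k * (suc n C suc k))
      ≡⟨ cong (4 *_) ([k+1]*[n+1]C[k+1]≡[n+1]*nCk n k) ⟩
    4 * (suc n * (n C k))
      ≡⟨ split n (n C k) ⟩
    2 * suc (n + n) * (n C k) + 2 * (n C k)
      ∎)
    where
    regroup : ∀ k x y → 4 * (suc k * y) + 2 * suc (k + k) * x + 2 * x ≡ 4 * (suc k * x + suc k * y)
    regroup = solve-∀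
    split : ∀ n x → 4 * (suc n * x) ≡ 2 * suc (n + n) * x + 2 * x
    split = solve-∀

  -- Divided by (k+1)·B(k+1) = 2(2k+1)·B(k), this is the recurrence of centralBinomQuotient.
  centralBinom*C-rec : ∀ a k →
    suc k * (centralBinom (suc a) * (suc a C suc k))
      ≡ 4 * (suc k * (centralBinom a * (a C suc k))) + 2 * suc (k + k) * (centralBinom a * (a C k))
  centralBinom*C-rec a k = begin
    suc k * (centralBinom (suc a) * (suc a C suc k))
      ≡⟨ x∙yz≈y∙xz (suc k) (centralBinom (suc a)) (suc a C suc k) ⟩
    centralBinom (suc a) * (suc k * (suc a C suc k))
      ≡⟨ cong (centralBinom (suc a) *_) ([k+1]*[n+1]C[k+1]≡[n+1]*nCk a k) ⟩
    centralBinom (suc a) * (suc a * (a C k))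
      ≡⟨ x∙yz≈yx∙z (centralBinom (suc a)) (suc a) (a C k) ⟩
    suc a * centralBinom (suc a) * (a C k)
      ≡⟨ cong (_* (a C k)) ([n+1]*centralBinom[n+1]≡2[2n+1]*centralBinom[n] a) ⟩
    2 * suc (a + a) * centralBinom a * (a C k)
      ≡⟨ xy∙z≈y∙xz (2 * suc (a + a)) (centralBinom a) (a C k) ⟩
    centralBinom a * (2 * suc (a + a) * (a C k))
      ≡⟨ cong (centralBinom a *_) (4[k+1]nC[k+1]+2[2k+1]nCk≡2[2n+1]nCk a k) ⟨
    centralBinom a * (4 * (suc k * (a C suc k)) + 2 * suc (k + k) * (a C k))
      ≡⟨ distribute k (centralBinom a) (a C k) (a C suc k) ⟩
    4 * (suc k * (centralBinom a * (a C suc k))) + 2 * suc (k + k) * (centralBinom a * (a C k))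
      ∎
    where
    distribute : ∀ k b x y → b * (4 * (suc k * y) + 2 * suc (k + k) * x)
                           ≡ 4 * (suc k * (b * y)) + 2 * suc (k + k) * (b * x)
    distribute = solve-∀

  centralBinomQuotient : ℕ → ℕ → ℕ
  centralBinomQuotient a       zero    = centralBinom a
  centralBinomQuotient zero    (suc k) = 0
  centralBinomQuotient (suc a) (suc k) = 4 * centralBinomQuotient a (suc k) + centralBinomQuotient a k

  centralBinom*quotient≡centralBinom*C : ∀ a k →
    centralBinom k * centralBinomQuotient a k ≡ centralBinom a * (a C k)
  centralBinom*quotient≡centralBinom*C a       zero    =
    trans (*-identityˡ (centralBinom a)) (sym (*-identityʳ (centralBinom a)))
  centralBinom*quotient≡centralBinom*C zero    (suc k) = *-zeroʳ (centralBinom (suc k))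
  centralBinom*quotient≡centralBinom*C (suc a) (suc k) = *-cancelˡ-≡ _ _ (suc k) (begin
    suc k * (centralBinom (suc k) * (4 * Q₁ + Q₀))
      ≡⟨ distribute k (centralBinom (suc k)) Q₁ Q₀ ⟩
    4 * (suc k * (centralBinom (suc k) * Q₁)) + suc k * centralBinom (suc k) * Q₀
      ≡⟨ cong₂ (λ x y → 4 * (suc k * x) + y * Q₀)
               (centralBinom*quotient≡centralBinom*C a (suc k))
               ([n+1]*centralBinom[n+1]≡2[2n+1]*centralBinom[n] k) ⟩
    4 * (suc k * (centralBinom a * (a C suc k))) + 2 * suc (k + k) * centralBinom k * Q₀
      ≡⟨ cong (4 * (suc k * (centralBinom a * (a C suc k))) +_) (*-assoc (2 * suc (k + k)) (centralBinom k) Q₀) ⟩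
    4 * (suc k * (centralBinom a * (a C suc k))) + 2 * suc (k + k) * (centralBinom k * Q₀)
      ≡⟨ cong (λ x → 4 * (suc k * (centralBinom a * (a C suc k))) + 2 * suc (k + k) * x)
              (centralBinom*quotient≡centralBinom*C a k) ⟩
    4 * (suc k * (centralBinom a * (a C suc k))) + 2 * suc (k + k) * (centralBinom a * (a C k))
      ≡⟨ centralBinom*C-rec a k ⟨
    suc k * (centralBinom (suc a) * (suc a C suc k))
      ∎)
    where
    Q₁ = centralBinomQuotient a (suc k)
    Q₀ = centralBinomQuotient a k
    distribute : ∀ k b x y → suc k * (b * (4 * x + y)) ≡ 4 * (suc k * (b * x)) + suc k * b * y
    distribute = solve-∀

  centralBinom∣centralBinom*C : ∀ a k → centralBinom k ∣ centralBinom a * (a C k)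
  centralBinom∣centralBinom*C a k = divides (centralBinomQuotient a k)
    (trans (sym (centralBinom*quotient≡centralBinom*C a k)) (*-comm (centralBinom k) (centralBinomQuotient a k)))

  pNumerator : ℕ → ℕ → ℕ → ℕ
  pNumerator ℓ m k = 2 ^ (3 * k) * (m C k) * (ℓ C k)

  centralBinom∣centralBinom[ℓ]*pNumerator : ∀ ℓ m k → centralBinom k ∣ centralBinom ℓ * pNumerator ℓ m k
  centralBinom∣centralBinom[ℓ]*pNumerator ℓ m k = ∣-trans (centralBinom∣centralBinom*C ℓ k)
    (*-monoʳ-∣ (centralBinom ℓ) (n∣m*n (2 ^ (3 * k) * (m C k))))

  centralBinom∣centralBinom[m]*pNumerator : ∀ ℓ m k → centralBinom k ∣ centralBinom m * pNumerator ℓ m k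
  centralBinom∣centralBinom[m]*pNumerator ℓ m k = ∣-trans (centralBinom∣centralBinom*C m k)
    (*-monoʳ-∣ (centralBinom m) (n∣m*n*o (2 ^ (3 * k)) (ℓ C k)))

open CentralBinomialDivisibility
  using ( centralBinom∣centralBinom*C; pNumerator
        ; centralBinom∣centralBinom[ℓ]*pNumerator; centralBinom∣centralBinom[m]*pNumerator)

open import Data.Nat using (ℕ; zero; suc; _≤_; NonZero)
import Data.Nat as ℕ
open import Data.Nat.Properties using (m*n≢0; *-identityˡ)
open import Data.Nat.Divisibility using (_∣_; divides)
open import Data.Nat.Combinatorics using (_C_)
open import Data.Integer as ℤ using (ℤ; +_)
import Data.Integer.Properties as ℤ
open import Data.Rational using (ℚ; _/_; _+_; _*_; toℚᵘ)
open import Data.Rational.Properties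
  using (toℚᵘ-injective; toℚᵘ-fromℚᵘ; toℚᵘ-homo-+; toℚᵘ-homo-*; /-cong; *-distribˡ-+; *-1-commutativeMonoid)
open import Data.Rational.Unnormalised as ℚᵘ using (mkℚᵘ; *≡*) renaming (_≃_ to _≃ᵘ_)
import Data.Rational.Unnormalised.Properties as ℚᵘ
open import Data.Product using (_×_; ∃; _,_)
open import Relation.Binary.PropositionalEquality
open import Algebra.Bundles using (CommutativeMonoid)
open import Algebra.Properties.CommutativeSemigroup (CommutativeMonoid.commutativeSemigroup *-1-commutativeMonoid)
  using (interchange)

toℚᵘ-/ : ∀ i n .{{_ : NonZero n}} → toℚᵘ (i / n) ≃ᵘ (i ℚᵘ./ n)
toℚᵘ-/ i (suc n) = toℚᵘ-fromℚᵘ (mkℚᵘ i n)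

cross-mul⇒/≡/ : ∀ i j m n .{{_ : NonZero m}} .{{_ : NonZero n}} → i ℤ.* + n ≡ j ℤ.* + m → i / m ≡ j / n
cross-mul⇒/≡/ i j (suc m) (suc n) eq =
  toℚᵘ-injective (ℚᵘ.≃-trans (toℚᵘ-/ i (suc m)) (ℚᵘ.≃-trans (*≡* eq) (ℚᵘ.≃-sym (toℚᵘ-/ j (suc n)))))

/-+-/ : ∀ i j m n .{{_ : NonZero m}} .{{_ : NonZero n}} →
        i / m + j / n ≡ ((i ℤ.* + n ℤ.+ j ℤ.* + m) / (m ℕ.* n)) {{m*n≢0 m n}}
/-+-/ i j (suc m) (suc n) = toℚᵘ-injective (begin
  toℚᵘ (i / suc m + j / suc n)            ≈⟨ toℚᵘ-homo-+ (i / suc m) (j / suc n) ⟩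
  toℚᵘ (i / suc m) ℚᵘ.+ toℚᵘ (j / suc n)  ≈⟨ ℚᵘ.+-cong (toℚᵘ-/ i (suc m)) (toℚᵘ-/ j (suc n)) ⟩
  mkℚᵘ i m ℚᵘ.+ mkℚᵘ j n                  ≈⟨ toℚᵘ-/ (i ℤ.* + suc n ℤ.+ j ℤ.* + suc m) (suc m ℕ.* suc n) ⟨
  toℚᵘ ((i ℤ.* + suc n ℤ.+ j ℤ.* + suc m) / (suc m ℕ.* suc n)) ∎)
  where open ℚᵘ.≃-Reasoning

/-*-/ : ∀ i j m n .{{_ : NonZero m}} .{{_ : NonZero n}} →
        i / m * (j / n) ≡ ((i ℤ.* j) / (m ℕ.* n)) {{m*n≢0 m n}}
/-*-/ i j (suc m) (suc n) = toℚᵘ-injective (begin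
  toℚᵘ (i / suc m * (j / suc n))          ≈⟨ toℚᵘ-homo-* (i / suc m) (j / suc n) ⟩
  toℚᵘ (i / suc m) ℚᵘ.* toℚᵘ (j / suc n)  ≈⟨ ℚᵘ.*-cong (toℚᵘ-/ i (suc m)) (toℚᵘ-/ j (suc n)) ⟩
  mkℚᵘ i m ℚᵘ.* mkℚᵘ j n                  ≈⟨ toℚᵘ-/ (i ℤ.* j) (suc m ℕ.* suc n) ⟨
  toℚᵘ ((i ℤ.* j) / (suc m ℕ.* suc n))    ∎)
  where open ℚᵘ.≃-Reasoning

ℤ→ℚ-homo-+ : ∀ x y → ℤ→ℚ x + ℤ→ℚ y ≡ ℤ→ℚ (x ℤ.+ y)
ℤ→ℚ-homo-+ x y = trans (/-+-/ x y 1 1) (/-cong (cong₂ ℤ._+_ (ℤ.*-identityʳ x) (ℤ.*-identityʳ y)) refl)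

ℤ→ℚ-homo-* : ∀ x y → ℤ→ℚ x * ℤ→ℚ y ≡ ℤ→ℚ (x ℤ.* y)
ℤ→ℚ-homo-* x y = /-*-/ x y 1 1

Integral : ℚ → Set
Integral q = ∃ λ (z : ℤ) → q ≡ ℤ→ℚ z

integral-+ : ∀ {p q} → Integral p → Integral q → Integral (p + q)
integral-+ (x , refl) (y , refl) = x ℤ.+ y , ℤ→ℚ-homo-+ x y

integral-* : ∀ {p q} → Integral p → Integral q → Integral (p * q)
integral-* (x , refl) (y , refl) = x ℤ.* y , ℤ→ℚ-homo-* x y

integral-sumTo : ∀ n (f : ℕ → ℚ) → (∀ k → Integral (f k)) → Integral (sumTo n f)
integral-sumTo zero    f integral-f = integral-f 0
integral-sumTo (suc n) f integral-f = integral-+ (integral-sumTo n f integral-f) (integral-f (suc n))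

*-distribˡ-sumTo : ∀ c n (f : ℕ → ℚ) → c * sumTo n f ≡ sumTo n (λ k → c * f k)
*-distribˡ-sumTo c zero    f = refl
*-distribˡ-sumTo c (suc n) f =
  trans (*-distribˡ-+ c (sumTo n f) (f (suc n))) (cong (_+ c * f (suc n)) (*-distribˡ-sumTo c n f))

integral-ℤ→ℚ*/ : ∀ x y n .{{_ : NonZero n}} → n ∣ x ℕ.* y → Integral (ℤ→ℚ (+ x) * (+ y / n))
integral-ℤ→ℚ*/ x y n (divides q x*y≡q*n) = + q , (begin
  ℤ→ℚ (+ x) * (+ y / n)                      ≡⟨ /-*-/ (+ x) (+ y) 1 n ⟩
  ((+ x ℤ.* + y) / (1 ℕ.* n)) {{m*n≢0 1 n}}  ≡⟨ cross-mul⇒/≡/ (+ x ℤ.* + y) (+ q) (1 ℕ.* n) 1 {{m*n≢0 1 n}} cross ⟩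
  ℤ→ℚ (+ q)                                  ∎)
  where
  open ≡-Reasoning
  cross : (+ x ℤ.* + y) ℤ.* + 1 ≡ + q ℤ.* + (1 ℕ.* n)
  cross = begin
    (+ x ℤ.* + y) ℤ.* + 1  ≡⟨ ℤ.*-identityʳ (+ x ℤ.* + y) ⟩
    + x ℤ.* + y            ≡⟨ ℤ.pos-* x y ⟨
    + (x ℕ.* y)            ≡⟨ cong +_ (trans x*y≡q*n (cong (q ℕ.*_) (sym (*-identityˡ n)))) ⟩
    + (q ℕ.* (1 ℕ.* n))    ≡⟨ ℤ.pos-* q (1 ℕ.* n) ⟩
    + q ℤ.* + (1 ℕ.* n)    ∎

integral-ℤ→ℚ*p : ∀ c ℓ m → (∀ k → centralBinom k ∣ c ℕ.* pNumerator ℓ m k) → Integral (ℤ→ℚ (+ c) * p ℓ m)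
integral-ℤ→ℚ*p c ℓ m divisible = subst Integral (sym (*-distribˡ-sumTo (ℤ→ℚ (+ c)) ℓ (term ℓ m)))
  (integral-sumTo ℓ _ λ k →
    integral-ℤ→ℚ*/ c (pNumerator ℓ m k) (centralBinom k) {{centralBinom-nonZero k}} (divisible k))

lemma5p7 : (∀ (k a : ℕ) → k ≤ a → centralBinom k ∣ Data.Nat._*_ (centralBinom a) (a C k))
    × (∀ (ℓ m : ℕ) → ∃ λ (z : ℤ) → ℤ→ℚ (+ centralBinom ℓ) * p ℓ m ≡ ℤ→ℚ z)
    × (∀ (ℓ m : ℕ) → ∃ λ (z : ℤ) →
         ℤ→ℚ (+ centralBinom ℓ) * ℤ→ℚ (+ centralBinom m) * (p ℓ m * p ℓ m) ≡ ℤ→ℚ z)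
lemma5p7 = (λ k a _ → centralBinom∣centralBinom*C a k) , integral-Bℓ*p , integral-Bℓ*Bm*p²
  where
  integral-Bℓ*p : ∀ ℓ m → Integral (ℤ→ℚ (+ centralBinom ℓ) * p ℓ m)
  integral-Bℓ*p ℓ m = integral-ℤ→ℚ*p (centralBinom ℓ) ℓ m (centralBinom∣centralBinom[ℓ]*pNumerator ℓ m)

  integral-Bm*p : ∀ ℓ m → Integral (ℤ→ℚ (+ centralBinom m) * p ℓ m)
  integral-Bm*p ℓ m = integral-ℤ→ℚ*p (centralBinom m) ℓ m (centralBinom∣centralBinom[m]*pNumerator ℓ m)

  integral-Bℓ*Bm*p² : ∀ ℓ m → Integral (ℤ→ℚ (+ centralBinom ℓ) * ℤ→ℚ (+ centralBinom m) * (p ℓ m * p ℓ m))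
  integral-Bℓ*Bm*p² ℓ m =
    subst Integral (sym (interchange (ℤ→ℚ (+ centralBinom ℓ)) (ℤ→ℚ (+ centralBinom m)) (p ℓ m) (p ℓ m)))
          (integral-* (integral-Bℓ*p ℓ m) (integral-Bm*p ℓ m))
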